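{- For every positive integer $k$, $$RR(\mathcal{E}(k,4)) = \begin{cases} 3 & \text{if } k \in\{2,3,4\},\\ 5 & \text{if } k \in\{6,7,8,10,11,14\},\\ 6 & \text{if } k\in\{5,9,12,13,15,18\},\\ 8 & \text{if } k\in\{17,19,22\},\\ 9 & \text{if } k\in\{1,23,24\},\\ 10 & \text{if } k\in\{16,20,21\} \text{ or } k \geq 25.\end{cases}$$
   Context: For a positive integer $k$ and an integer $j > -k$, $\mathcal{E}(k,j)$ denotes the equation $x+y+kz=(k+j)w$. A $2$-coloring of $[1,N]=\{1,2,\dots,N\}$ is a map $\chi:[1,N]\to\{0,1\}$; a solution $(x,y,z,w)$ with $x,y,z,w\in[1,N]$ (not necessarily distinct) is monochromatic if $\chi(x)=\chi(y)=\chi(z)=\chi(w)$. For an equation $\mathcal{E}$, $RR(\mathcal{E})$ denotes the minimum positive integer $N$ such that every $2$-coloring of $[1,N]$ admits a monochromatic solution to $\mathcal{E}$ in $[1,N]$. -}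

module Defs where

open import Data.Nat using (ℕ; zero; suc; _+_; _*_; _≤_; _<_)
open import Data.Bool using (Bool)
open import Data.List using (List; []; _∷_)
open import Data.Product using (∃-syntax; _×_)
open import Data.Sum using (_⊎_)
open import Relation.Binary.PropositionalEquality using (_≡_)
open import Relation.Nullary using (¬_)

InRange : ℕ → ℕ → Set
InRange N x = 1 ≤ x × x ≤ N

IsSolE4 : ℕ → ℕ → ℕ → ℕ → ℕ → Set
IsSolE4 k x y z w = x + y + k * z ≡ (k + 4) * w

-- a 2-coloring of [1,N] is represented by a map ℕ → Bool
-- (only its values on [1,N] are ever consulted)
HasMonoSol : ℕ → ℕ → (ℕ → Bool) → Set
HasMonoSol k N χ =
  ∃[ x ] ∃[ y ] ∃[ z ] ∃[ w ]
    (InRange N x × InRange N y × InRange N z × InRange N w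
     × IsSolE4 k x y z w
     × χ x ≡ χ w × χ y ≡ χ w × χ z ≡ χ w)

RadoProp : ℕ → ℕ → Set
RadoProp k N = (χ : ℕ → Bool) → HasMonoSol k N χ

RR-E4-is : ℕ → ℕ → Set
RR-E4-is k N = 1 ≤ N × RadoProp k N × (∀ M → 1 ≤ M → M < N → ¬ RadoProp k M)

-- the value claimed by the theorem
-- values for k = 1 .. 24 (listed in order); 10 for k ≥ 25
smallValues : List ℕ
smallValues = 9 ∷ 3 ∷ 3 ∷ 3 ∷ 6 ∷ 5 ∷ 5 ∷ 5 ∷ 6 ∷ 5 ∷ 5 ∷ 6 ∷ 6 ∷ 5 ∷ 6 ∷ 10 ∷ 8 ∷ 6 ∷ 8 ∷ 10 ∷ 10 ∷ 8 ∷ 9 ∷ 9 ∷ []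

nth : List ℕ → ℕ → ℕ
nth [] _ = 10
nth (v ∷ vs) (suc zero) = v
nth (v ∷ vs) (suc (suc n)) = nth vs (suc n)
nth (v ∷ vs) zero = 10

rrValue : ℕ → ℕ
rrValue k = nth smallValues k

-- For fixed k and N, RR(E(k,4)) = N is decidable: colour 1, 2, 3, ... in turn and abandon a
-- branch as soon as the points coloured so far carry a monochromatic solution.  Running this
-- search while type checking settles every k < 35, including k = 0, where the equation is
-- x + y = 4w.  For k ≥ 35 every solution inside [1,9] has z = w, because k |z - w| = |x + y - 4w|
-- is at most 34; so on [1,9] the solutions are those of x + y = 4w, and conversely every
-- solution of x + y = 4w gives the solution (x, y, w, w) for any k.  Hence RR(E(k,4)) = 10.

module Submission where

open import Defs
open import Data.Nat using (ℕ; zero; suc; pred; _+_; _*_; _≤_; _<_; z≤n; s≤s; s≤s⁻¹; _≡ᵇ_; _≟_; _≤?_; _<?_; NonZero; >-nonZero)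
open import Data.Nat.Properties
open import Data.Nat.DivMod using (_/_; m*n/n≡m)
open import Data.Bool using (Bool; true; false; T; if_then_else_)
open import Data.Unit using (tt)
import Data.Bool.Properties as Bool
open import Data.Empty using (⊥-elim)
open import Data.Product using (_×_; _,_; ∃-syntax)
open import Data.List using ([]; _∷_; length)
open import Data.Sum using (_⊎_; inj₁; inj₂)
open import Function.Bundles using (_⇔_; mk⇔; Equivalence)
open import Relation.Binary.Definitions using (tri<; tri≈; tri>)
open import Relation.Binary.PropositionalEquality
open import Relation.Nullary using (¬_; Dec; yes; no; _because_; invert)
open import Relation.Nullary.Decidable using (map′; _×-dec_; _⊎-dec_; ¬?; from-yes)
open import Relation.Unary using (Decidable)

∃-inRange? : {P : ℕ → Set} → Decidable P → ∀ n → Dec (∃[ x ] (InRange n x × P x))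
∃-inRange? P? zero = no λ { (_ , (1≤x , x≤0) , _) → ≤⇒≯ x≤0 1≤x }
∃-inRange? {P} P? (suc n) = map′ join split (P? (suc n) ⊎-dec ∃-inRange? P? n)
  where
  join : P (suc n) ⊎ ∃[ x ] (InRange n x × P x) → ∃[ x ] (InRange (suc n) x × P x)
  join (inj₁ p)                       = suc n , (s≤s z≤n , ≤-refl) , p
  join (inj₂ (x , (1≤x , x≤n) , p)) = x , (1≤x , m≤n⇒m≤1+n x≤n) , p

  split : ∃[ x ] (InRange (suc n) x × P x) → P (suc n) ⊎ ∃[ x ] (InRange n x × P x)
  split (x , (1≤x , x≤1+n) , p) with m≤n⇒m<n∨m≡n x≤1+n
  ... | inj₁ x<1+n = inj₂ (x , (1≤x , s≤s⁻¹ x<1+n) , p)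
  ... | inj₂ refl  = inj₁ p

∃-inRange-unique? : {P : ℕ → Set} → Decidable P → ∀ c → (∀ {x} → P x → x ≡ c) → ∀ n →
                    Dec (∃[ x ] (InRange n x × P x))
∃-inRange-unique? {P} P? c P⇒≡c n = map′
  (λ { (r , p) → c , r , p })
  (λ { (x , r , p) → subst (λ x → InRange n x × P x) (P⇒≡c p) (r , p) })
  ((1 ≤? c ×-dec c ≤? n) ×-dec P? c)

instance
  +4-nonZero : ∀ {k} → NonZero (k + 4)
  +4-nonZero {k} = >-nonZero (≤-trans (s≤s z≤n) (m≤n+m 4 k))

isSolE4⇒w≡[x+y+kz]/[k+4] : ∀ k x y z {w} → IsSolE4 k x y z w → w ≡ (x + y + k * z) / (k + 4)
isSolE4⇒w≡[x+y+kz]/[k+4] k x y z {w} e = sym (begin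
  (x + y + k * z) / (k + 4) ≡⟨ cong (_/ (k + 4)) (trans e (*-comm (k + 4) w)) ⟩
  w * (k + 4) / (k + 4)      ≡⟨ m*n/n≡m w (k + 4) ⟩
  w                          ∎)
  where open ≡-Reasoning

-- Colours are compared with that of x before entering the inner loops, so that the search
-- prunes early; w is determined by x, y and z.
hasMonoSol? : ∀ k n χ → Dec (HasMonoSol k n χ)
hasMonoSol? k n χ = map′
  (λ { (x , rx , y , ry , cy , z , rz , cz , w , rw , cw , e) →
         x , y , z , w , rx , ry , rz , rw , e , sym cw , trans cy (sym cw) , trans cz (sym cw) })
  (λ { (x , y , z , w , rx , ry , rz , rw , e , cx , cy , cz) →
         x , rx , y , ry , trans cy (sym cx) , z , rz , trans cz (sym cx) , w , rw , sym cx , e })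
  (∃-inRange? (λ x →
     ∃-inRange? (λ y → (χ y Bool.≟ χ x) ×-dec
       ∃-inRange? (λ z → (χ z Bool.≟ χ x) ×-dec
         ∃-inRange-unique? (λ w → (χ w Bool.≟ χ x) ×-dec (x + y + k * z ≟ (k + 4) * w))
           ((x + y + k * z) / (k + 4)) (λ (_ , e) → isSolE4⇒w≡[x+y+kz]/[k+4] k x y z e) n) n) n) n)

hasMonoSol-mono : ∀ {k n N χ} → n ≤ N → HasMonoSol k n χ → HasMonoSol k N χ
hasMonoSol-mono n≤N (x , y , z , w , rx , ry , rz , rw , s) =
  x , y , z , w , widen rx , widen ry , widen rz , widen rw , s
  where
  widen : ∀ {i} → InRange _ i → InRange _ i
  widen (1≤i , i≤n) = 1≤i , ≤-trans i≤n n≤N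

radoProp-mono : ∀ {k M N} → M ≤ N → RadoProp k M → RadoProp k N
radoProp-mono {k} M≤N R χ = hasMonoSol-mono {k} M≤N (R χ)

¬radoProp-0 : ∀ {k} → ¬ RadoProp k 0
¬radoProp-0 R with R (λ _ → true)
... | _ , _ , _ , _ , (1≤x , x≤0) , _ = ≤⇒≯ x≤0 1≤x

Agrees : ℕ → (ℕ → Bool) → (ℕ → Bool) → Set
Agrees n ψ χ = ∀ {i} → InRange n i → ψ i ≡ χ i

hasMonoSol-resp : ∀ {k n ψ χ} → Agrees n ψ χ → HasMonoSol k n χ → HasMonoSol k n ψ
hasMonoSol-resp {ψ = ψ} {χ} ψ≈χ (x , y , z , w , rx , ry , rz , rw , s , cx , cy , cz) =
  x , y , z , w , rx , ry , rz , rw , s , recolour rx cx , recolour ry cy , recolour rz cz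
  where
  recolour : ∀ {i} → InRange _ i → χ i ≡ χ w → ψ i ≡ ψ w
  recolour ri ci = trans (ψ≈χ ri) (trans ci (sym (ψ≈χ rw)))

extend : ℕ → (ℕ → Bool) → Bool → ℕ → Bool
extend n χ b i = if i ≡ᵇ suc n then b else χ i

agrees-extend : ∀ {n ψ χ b} → Agrees n ψ χ → ψ (suc n) ≡ b → Agrees (suc n) ψ (extend n χ b)
agrees-extend {n} {ψ} ψ≈χ ψn≡b {i} (1≤i , i≤1+n) with i ≡ᵇ suc n in i≟1+n
... | true  = trans (cong ψ (≡ᵇ⇒≡ i (suc n) (subst T (sym i≟1+n) tt))) ψn≡b
... | false = ψ≈χ (1≤i , s≤s⁻¹ (≤∧≢⇒< i≤1+n λ i≡1+n → subst T i≟1+n (≡⇒≡ᵇ i (suc n) i≡1+n)))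

module Search (k N : ℕ) where

  Forced : ℕ → (ℕ → Bool) → Set
  Forced n χ = ∀ ψ → Agrees n ψ χ → HasMonoSol k N ψ

  forced-split : ∀ {n χ} → Forced (suc n) (extend n χ false) → Forced (suc n) (extend n χ true) →
                 Forced n χ
  forced-split f t ψ ψ≈χ with ψ (suc _) in ψn
  ... | false = f ψ (agrees-extend ψ≈χ ψn)
  ... | true  = t ψ (agrees-extend ψ≈χ ψn)

  forced-by : ∀ {n χ} → n ≤ N → HasMonoSol k n χ → Forced n χ
  forced-by n≤N s ψ ψ≈χ = hasMonoSol-mono {k} n≤N (hasMonoSol-resp {k} ψ≈χ s)

  -- χ matters only on the already coloured points [1,n].  Matching on `true because _' instead
  -- of `yes _' inspects only the Boolean part of hasMonoSol?, so no proofs are built while searching.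
  explore : ∀ d {n} → d + n ≡ N → ∀ χ → Forced n χ ⊎ ¬ RadoProp k N
  explore d {n} d+n≡N χ with hasMonoSol? k n χ
  ... | true because [s] = inj₁ (forced-by (subst (n ≤_) d+n≡N (m≤n+m n d)) (invert [s]))
  explore zero    refl  χ | false because [¬s] = inj₂ λ R → invert [¬s] (R χ)
  explore (suc d) d+n≡N χ | false because _
    with explore d (trans (+-suc d _) d+n≡N) (extend _ χ false)
       | explore d (trans (+-suc d _) d+n≡N) (extend _ χ true)
  ... | inj₁ f | inj₁ t = inj₁ (forced-split f t)
  ... | inj₂ ¬R | _     = inj₂ ¬R
  ... | _      | inj₂ ¬R = inj₂ ¬R

  radoProp? : Dec (RadoProp k N)
  radoProp? with explore N (+-identityʳ N) (λ _ → false)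
  ... | inj₁ f  = yes λ ψ → f ψ λ { (1≤i , i≤0) → ⊥-elim (≤⇒≯ i≤0 1≤i) }
  ... | inj₂ ¬R = no ¬R

open Search using (radoProp?)

rr-E4-is-intro : ∀ {k N} → 1 ≤ N → RadoProp k N → ¬ RadoProp k (pred N) → RR-E4-is k N
rr-E4-is-intro {k} 1≤N R ¬R = 1≤N , R , λ M _ M<N R′ → ¬R (radoProp-mono {k} (<⇒≤pred M<N) R′)

rr-E4-is⇒¬radoProp-pred : ∀ {k N} → RR-E4-is k N → ¬ RadoProp k (pred N)
rr-E4-is⇒¬radoProp-pred {k} {suc zero}    _            = ¬radoProp-0 {k}
rr-E4-is⇒¬radoProp-pred {k} {suc (suc M)} (_ , _ , ¬R) = ¬R (suc M) (s≤s z≤n) ≤-refl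

RR-E4-is? : ∀ k N → Dec (RR-E4-is k N)
RR-E4-is? k N = map′
  (λ { (1≤N , R , ¬R) → rr-E4-is-intro {k} 1≤N R ¬R })
  (λ { rr@(1≤N , R , _) → 1≤N , R , rr-E4-is⇒¬radoProp-pred {k} rr })
  (1 ≤? N ×-dec radoProp? k N ×-dec ¬? (radoProp? k (pred N)))

rr-E4-below-35 : ∀ {k} → k < 35 → RR-E4-is k (rrValue k)
rr-E4-below-35 = from-yes (allUpTo? (λ k → RR-E4-is? k (rrValue k)) 35)

isSolE4₀⇔diagonal : ∀ k x y z w → IsSolE4 0 x y z w ⇔ IsSolE4 k x y w w
isSolE4₀⇔diagonal k x y _ w = mk⇔ to from
  where
  open ≡-Reasoning
  expand : (k + 4) * w ≡ 4 * w + k * w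
  expand = trans (*-distribʳ-+ w k 4) (+-comm (k * w) (4 * w))

  to : x + y + 0 ≡ 4 * w → x + y + k * w ≡ (k + 4) * w
  to e = begin
    x + y + k * w ≡⟨ cong (_+ k * w) (trans (sym (+-identityʳ (x + y))) e) ⟩
    4 * w + k * w ≡⟨ sym expand ⟩
    (k + 4) * w   ∎

  from : x + y + k * w ≡ (k + 4) * w → x + y + 0 ≡ 4 * w
  from e = trans (+-identityʳ (x + y)) (+-cancelʳ-≡ (k * w) (x + y) (4 * w) (trans e expand))

isSolE4-z<w⇒k+4w≤x+y : ∀ {k x y z w} → IsSolE4 k x y z w → z < w → k + 4 * w ≤ x + y
isSolE4-z<w⇒k+4w≤x+y {k} {x} {y} {z} {w} e z<w = +-cancelˡ-≤ (k * z) (k + 4 * w) (x + y) (begin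
  k * z + (k + 4 * w) ≡⟨ sym (+-assoc (k * z) k (4 * w)) ⟩
  k * z + k + 4 * w   ≡⟨ cong (_+ 4 * w) (trans (+-comm (k * z) k) (sym (*-suc k z))) ⟩
  k * suc z + 4 * w   ≤⟨ +-monoˡ-≤ (4 * w) (*-monoʳ-≤ k z<w) ⟩
  k * w + 4 * w       ≡⟨ sym (*-distribʳ-+ w k 4) ⟩
  (k + 4) * w         ≡⟨ sym e ⟩
  x + y + k * z       ≡⟨ +-comm (x + y) (k * z) ⟩
  k * z + (x + y)     ∎)
  where open ≤-Reasoning

isSolE4-w<z⇒k+x+y≤4w : ∀ {k x y z w} → IsSolE4 k x y z w → w < z → k + (x + y) ≤ 4 * w
isSolE4-w<z⇒k+x+y≤4w {k} {x} {y} {z} {w} e w<z = +-cancelˡ-≤ (k * w) (k + (x + y)) (4 * w) (begin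
  k * w + (k + (x + y)) ≡⟨ sym (+-assoc (k * w) k (x + y)) ⟩
  k * w + k + (x + y)   ≡⟨ cong (_+ (x + y)) (trans (+-comm (k * w) k) (sym (*-suc k w))) ⟩
  k * suc w + (x + y)   ≤⟨ +-monoˡ-≤ (x + y) (*-monoʳ-≤ k w<z) ⟩
  k * z + (x + y)       ≡⟨ +-comm (k * z) (x + y) ⟩
  x + y + k * z         ≡⟨ e ⟩
  (k + 4) * w           ≡⟨ *-distribʳ-+ w k 4 ⟩
  k * w + 4 * w         ∎)
  where open ≤-Reasoning

isSolE4⇒z≡w : ∀ {k N x y z w} → 4 * N ≤ suc k → InRange N x → InRange N y → InRange N w →
              IsSolE4 k x y z w → z ≡ w
isSolE4⇒z≡w {k} {N} {x} {y} {z} {w} 4N≤1+k (1≤x , x≤N) (1≤y , y≤N) (1≤w , w≤N) e with <-cmp z w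
... | tri≈ _ z≡w _ = z≡w
... | tri< z<w _ _ = ⊥-elim (<-irrefl refl (begin-strict
  k + 1         <⟨ +-monoʳ-< k (s≤s (s≤s z≤n)) ⟩
  k + 4         ≤⟨ +-monoʳ-≤ k (*-monoʳ-≤ 4 1≤w) ⟩
  k + 4 * w     ≤⟨ isSolE4-z<w⇒k+4w≤x+y {k} {x} {y} e z<w ⟩
  x + y         ≤⟨ +-mono-≤ x≤N y≤N ⟩
  N + N         ≤⟨ +-monoʳ-≤ N (m≤m+n N _) ⟩
  4 * N         ≤⟨ 4N≤1+k ⟩
  suc k         ≡⟨ +-comm 1 k ⟩
  k + 1         ∎))
  where open ≤-Reasoning
... | tri> _ _ w<z = ⊥-elim (<-irrefl refl (begin-strict
  k + 1         <⟨ +-monoʳ-< k (s≤s (s≤s z≤n)) ⟩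
  k + 2         ≤⟨ +-monoʳ-≤ k (+-mono-≤ 1≤x 1≤y) ⟩
  k + (x + y)   ≤⟨ isSolE4-w<z⇒k+x+y≤4w {k} {x} {y} e w<z ⟩
  4 * w         ≤⟨ *-monoʳ-≤ 4 w≤N ⟩
  4 * N         ≤⟨ 4N≤1+k ⟩
  suc k         ≡⟨ +-comm 1 k ⟩
  k + 1         ∎))
  where open ≤-Reasoning

hasMonoSol₀⇒hasMonoSol : ∀ {k N χ} → HasMonoSol 0 N χ → HasMonoSol k N χ
hasMonoSol₀⇒hasMonoSol {k} (x , y , z , w , rx , ry , rz , rw , e , cx , cy , cz) =
  x , y , w , w , rx , ry , rw , rw , Equivalence.to (isSolE4₀⇔diagonal k x y z w) e , cx , cy , refl

hasMonoSol⇒hasMonoSol₀ : ∀ {k N χ} → 4 * N ≤ suc k → HasMonoSol k N χ → HasMonoSol 0 N χ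
hasMonoSol⇒hasMonoSol₀ {k} 4N≤1+k (x , y , z , w , rx , ry , rz , rw , e , cx , cy , cz)
  with isSolE4⇒z≡w {k} {z = z} 4N≤1+k rx ry rw e
... | refl = x , y , z , w , rx , ry , rz , rw , Equivalence.from (isSolE4₀⇔diagonal k x y z w) e , cx , cy , cz

rr-E4-transfer : ∀ {k N} → 4 * pred N ≤ suc k → RR-E4-is 0 N → RR-E4-is k N
rr-E4-transfer {k} {N} 4N′≤1+k (1≤N , R₀ , ¬R₀) =
  1≤N , (λ χ → hasMonoSol₀⇒hasMonoSol {k} (R₀ χ)) , λ M 1≤M M<N R → ¬R₀ M 1≤M M<N λ χ →
    hasMonoSol⇒hasMonoSol₀ {k} (≤-trans (*-monoʳ-≤ 4 (<⇒≤pred M<N)) 4N′≤1+k) (R χ)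

nth-beyond : ∀ vs {k} → length vs < k → nth vs k ≡ 10
nth-beyond []       _                    = refl
nth-beyond (_ ∷ _)  {zero}        _      = refl
nth-beyond (_ ∷ _)  {suc zero}    (s≤s ())
nth-beyond (_ ∷ vs) {suc (suc k)} (s≤s l<k) = nth-beyond vs l<k

theorem6 : (k : ℕ) → 1 ≤ k → RR-E4-is k (rrValue k)
theorem6 k _ with k <? 35
... | yes k<35 = rr-E4-below-35 k<35
... | no k≮35  = subst (RR-E4-is k) (sym (nth-beyond smallValues (≤-trans (m≤m+n 25 10) 35≤k)))
                   (rr-E4-transfer (s≤s 35≤k) (rr-E4-below-35 (s≤s z≤n)))
  where
  35≤k : 35 ≤ k
  35≤k = ≮⇒≥ k≮35
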